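{- Let $n\geq 2$. Every finite $n$-dimensional partial order with realizers $\mathbf{P}$ of size $m$ admits a unique rigid embedding into $\mathbf{m}^n$.
   Context: An $n$-dimensional partial order with realizers is a structure $(P,<,<_1,\ldots,<_n)$, $P\neq\emptyset$, each $<_i$ a strict linear order on $P$ and $a<b$ iff $a<_i b$ for all $i$. For $m\in\mathbb{N}^+$, $\mathbf{m}^n_{<_1,\ldots,<_n}=(\{1,\ldots,m\}^n,<,<_1,\ldots,<_n)$ where $<$ is the product order ($\mathbf{a}<\mathbf{b}$ iff $a_j\leq b_j$ for all $j$ and $\mathbf{a}\neq\mathbf{b}$) and $<_i$ is the lexicographic order comparing coordinates in the cyclic order $i,i+1,\ldots,n,1,\ldots,i-1$. A rigid embedding of $\mathbf{P}$ into $\mathbf{m}^n$ (with $m=|P|$) is an embedding of $\mathbf{P}$ into $\mathbf{m}^n_{<_1,\ldots,<_n}$ (injective, preserving and reflecting all $n+1$ relations) whose image contains no two distinct points sharing a common coordinate. -}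

module Defs where

open import Data.Nat using (ℕ; zero; suc)
open import Data.Nat.DivMod using (_mod_)
open import Data.Fin using (Fin; toℕ) renaming (_<_ to _<ᶠ_; _≤_ to _≤ᶠ_)
open import Data.Nat using () renaming (_<_ to _<ℕ_)
open import Data.Nat using (_+_)
open import Data.Product using (Σ; _×_; Σ-syntax)
open import Relation.Binary.PropositionalEquality using (_≡_; _≢_)
open import Relation.Binary.Structures using (IsStrictTotalOrder)
open import Function.Bundles using (_⇔_)

record PORealizers (n : ℕ) (A : Set) : Set₁ where
  field
    _<_        : A → A → Set
    lt         : Fin n → A → A → Set
    nonempty   : A
    lt-linear  : (i : Fin n) → IsStrictTotalOrder _≡_ (lt i)
    <-realized : (a b : A) → (a < b) ⇔ ((i : Fin n) → lt i a b)

-- Points of m^n: coordinates are Fin m (values 0..m-1 stand for 1..m).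
Point : ℕ → ℕ → Set
Point n m = Fin n → Fin m

ProdLt : {n m : ℕ} → Point n m → Point n m → Set
ProdLt {n} x y = ((j : Fin n) → x j ≤ᶠ y j) × (x ≢ y)

-- rot i t = the coordinate i + t (mod n), i.e. the t-th coordinate in the
-- cyclic order i, i+1, ..., n, 1, ..., i-1.
rot : {n : ℕ} → Fin n → Fin n → Fin n
rot {suc n} i t = (toℕ i + toℕ t) mod (suc n)

LexLt : {n m : ℕ} → Fin n → Point n m → Point n m → Set
LexLt {n} i x y =
  Σ[ k ∈ Fin n ] (((t : Fin n) → toℕ t <ℕ toℕ k → x (rot i t) ≡ y (rot i t))
                  × (x (rot i k) <ᶠ y (rot i k)))

record IsEmbedding {n m : ℕ} {A : Set} (P : PORealizers n A)
                   (f : A → Point n m) : Set where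
  open PORealizers P
  field
    injective : (a b : A) → f a ≡ f b → a ≡ b
    pres-<    : (a b : A) → (a < b) ⇔ ProdLt (f a) (f b)
    pres-lt   : (i : Fin n) (a b : A) → lt i a b ⇔ LexLt i (f a) (f b)

IsRigid : {n m : ℕ} {A : Set} → (A → Point n m) → Set
IsRigid {n} {m} {A} f = (a b : A) (j : Fin n) → f a j ≡ f b j → a ≡ b

record IsRigidEmbedding {n m : ℕ} {A : Set} (P : PORealizers n A)
                        (f : A → Point n m) : Set where
  field
    embedding : IsEmbedding P f
    rigid     : IsRigid f

module Submission where

-- Rigidity makes every coordinate of an embedding into m^n injective, and then the
-- i-th lexicographic order compares two points by their i-th coordinate alone,
-- because coordinate i is the first one it inspects. So a rigid embedding is the
-- same as a family of n order embeddings (A, <_i) → {1, …, m}; as |A| = m each of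
-- them is a bijection, and the only such monotone bijection sends a to its rank,
-- the number of elements below a in <_i. The hypothesis n ≥ 2 is only used
-- for n ≥ 1.

open import Defs
open import Data.Nat as ℕ using (ℕ; _≤_; z≤n; s≤s)
import Data.Nat.Properties as ℕ
open import Data.Nat.DivMod using (_%_; m<n⇒m%n≡m)
open import Data.Fin as Fin using (Fin; zero; suc; toℕ; fromℕ<; punchOut; opposite)
import Data.Fin.Properties as Fin
open import Data.Fin.Subset using (Subset; _∈_; _∉_; _⊂_; ⊤; ∣_∣)
open import Data.Fin.Subset.Properties using (∈⊤; ∣⊤∣≡n; p⊂q⇒∣p∣<∣q∣)
open import Data.Vec using (tabulate)
open import Data.Vec.Properties using (lookup∘tabulate; []=⇒lookup; lookup⇒[]=)
open import Data.Empty using (⊥-elim)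
open import Data.Product using (_×_; Σ-syntax; _,_; proj₁; proj₂)
open import Function using (_∘_)
open import Function.Bundles using (_↔_; _⇔_; mk⇔; Inverse; Equivalence)
open import Function.Construct.Composition using (_⇔-∘_)
open import Function.Construct.Symmetry using (⇔-sym)
open import Function.Definitions using (Injective; StrictlySurjective)
open import Level using (Level)
open import Relation.Binary.Core using (Rel)
open import Relation.Binary.Definitions using (Monotonic₁; tri<; tri≈; tri>)
open import Relation.Binary.PropositionalEquality
  using (_≡_; _≢_; refl; sym; trans; cong; cong-app; subst; subst₂; module ≡-Reasoning)
open import Relation.Binary.Structures using (IsStrictTotalOrder)
open import Relation.Nullary using (yes; no; contradiction)
open import Relation.Nullary.Decidable using (does; dec-true)
open import Relation.Unary using (Pred; Decidable)

private
  variable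
    ℓ : Level
    m M n : ℕ
    A : Set

subsetOf : {P : Pred (Fin m) ℓ} → Decidable P → Subset m
subsetOf P? = tabulate (does ∘ P?)

module _ {P : Pred (Fin m) ℓ} (P? : Decidable P) {x : Fin m} where

  ∈-subsetOf⁺ : P x → x ∈ subsetOf P?
  ∈-subsetOf⁺ px = lookup⇒[]= x _ (trans (lookup∘tabulate (does ∘ P?) x) (dec-true (P? x) px))

  ∈-subsetOf⁻ : x ∈ subsetOf P? → P x
  ∈-subsetOf⁻ x∈ with P? x | trans (sym (lookup∘tabulate (does ∘ P?) x)) ([]=⇒lookup x∈)
  ... | yes px | _ = px
  ... | no _   | ()

injective⇒strictlySurjective : {f : Fin m → Fin m} → Injective _≡_ _≡_ f → StrictlySurjective _≡_ f
injective⇒strictlySurjective {ℕ.suc m} {f} f-inj k with Fin.any? (λ x → f x Fin.≟ k)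
... | yes hit = hit
... | no miss = ⊥-elim (ℕ.1+n≰n (Fin.injective⇒≤ punchedOut-injective))
  where
  k≢f : ∀ x → k ≢ f x
  k≢f x k≡fx = miss (x , sym k≡fx)

  punchedOut-injective : Injective _≡_ _≡_ (λ x → punchOut (k≢f x))
  punchedOut-injective eq = f-inj (Fin.punchOut-injective (k≢f _) (k≢f _) eq)

opposite-antitone : {k l : Fin m} → k Fin.< l → opposite l Fin.< opposite k
opposite-antitone {m} {k} {l} k<l =
  subst₂ ℕ._<_ (sym (Fin.opposite-prop l)) (sym (Fin.opposite-prop k))
    (ℕ.∸-monoʳ-< (s≤s k<l) (Fin.toℕ<n l))

strictMono⇒growth : {σ : Fin (ℕ.suc m) → Fin M} → Monotonic₁ Fin._<_ Fin._<_ σ →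
  ∀ k → toℕ (σ zero) ℕ.+ toℕ k ≤ toℕ (σ k)
strictMono⇒growth σ-mono zero = ℕ.≤-reflexive (ℕ.+-identityʳ _)
strictMono⇒growth {ℕ.suc m} {σ = σ} σ-mono (suc k) = begin
  toℕ (σ zero) ℕ.+ ℕ.suc (toℕ k)  ≡⟨ ℕ.+-suc _ _ ⟩
  ℕ.suc (toℕ (σ zero)) ℕ.+ toℕ k  ≤⟨ ℕ.+-monoˡ-≤ (toℕ k) (σ-mono {zero} {suc zero} (s≤s z≤n)) ⟩
  toℕ (σ (suc zero)) ℕ.+ toℕ k    ≤⟨ strictMono⇒growth (λ k<l → σ-mono (s≤s k<l)) k ⟩
  toℕ (σ (suc k))                 ∎
  where open ℕ.≤-Reasoning

strictMono⇒≤ : {σ : Fin m → Fin M} → Monotonic₁ Fin._<_ Fin._<_ σ → ∀ k → toℕ k ≤ toℕ (σ k)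
strictMono⇒≤ {ℕ.suc m} {σ = σ} σ-mono k =
  ℕ.≤-trans (ℕ.m≤n+m (toℕ k) (toℕ (σ zero))) (strictMono⇒growth σ-mono k)

-- The lower bound for the conjugate opposite ∘ σ ∘ opposite is an upper bound for σ.
strictMono⇒id : {σ : Fin m → Fin m} → Monotonic₁ Fin._<_ Fin._<_ σ → ∀ k → σ k ≡ k
strictMono⇒id {m} {σ} σ-mono k = Fin.toℕ-injective (ℕ.≤-antisym σk≤k (strictMono⇒≤ σ-mono k))
  where
  opposite-bound : toℕ (opposite k) ≤ toℕ (opposite (σ k))
  opposite-bound =
    subst (λ j → toℕ (opposite k) ≤ toℕ (opposite (σ j))) (Fin.opposite-involutive k)
      (strictMono⇒≤ (opposite-antitone ∘ σ-mono ∘ opposite-antitone) (opposite k))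

  σk≤k : toℕ (σ k) ≤ toℕ k
  σk≤k = ℕ.≮⇒≥ λ k<σk → ℕ.<⇒≱ (ℕ.∸-monoʳ-< (s≤s k<σk) (Fin.toℕ<n (σ k)))
    (subst₂ _≤_ (Fin.opposite-prop k) (Fin.opposite-prop (σ k)) opposite-bound)

module StrictMono {_≺_ : Rel A ℓ} (≺-sto : IsStrictTotalOrder _≡_ _≺_) where
  open IsStrictTotalOrder ≺-sto using (compare)

  injective : {u : A → Fin m} → Monotonic₁ _≺_ Fin._<_ u → Injective _≡_ _≡_ u
  injective u-mono {a} {b} ua≡ub with compare a b
  ... | tri< a≺b _ _ = contradiction ua≡ub (Fin.<⇒≢ (u-mono a≺b))
  ... | tri≈ _ a≡b _ = a≡b
  ... | tri> _ _ b≺a = contradiction (sym ua≡ub) (Fin.<⇒≢ (u-mono b≺a))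

  reflects : {u : A → Fin m} → Monotonic₁ _≺_ Fin._<_ u → ∀ {a b} → u a Fin.< u b → a ≺ b
  reflects u-mono {a} {b} ua<ub with compare a b
  ... | tri< a≺b _ _  = a≺b
  ... | tri≈ _ refl _ = ⊥-elim (Fin.<-irrefl refl ua<ub)
  ... | tri> _ _ b≺a  = ⊥-elim (Fin.<-asym ua<ub (u-mono b≺a))

  -- u ∘ v⁻¹ is a strictly monotone endomap of Fin m, hence the identity.
  unique : {u v : A → Fin m} → Monotonic₁ _≺_ Fin._<_ u → Monotonic₁ _≺_ Fin._<_ v →
    StrictlySurjective _≡_ v → ∀ a → u a ≡ v a
  unique {u = u} {v} u-mono v-mono v-surj a = begin
    u a              ≡⟨ cong u (injective v-mono (sym (proj₂ (v-surj (v a))))) ⟩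
    u (v⁻¹ (v a))    ≡⟨ strictMono⇒id (u-mono ∘ reflects v-mono ∘ v⁻¹-mono) (v a) ⟩
    v a              ∎
    where
    open ≡-Reasoning
    v⁻¹ : Fin _ → A
    v⁻¹ k = proj₁ (v-surj k)

    v⁻¹-mono : ∀ {k l} → k Fin.< l → v (v⁻¹ k) Fin.< v (v⁻¹ l)
    v⁻¹-mono = subst₂ Fin._<_ (sym (proj₂ (v-surj _))) (sym (proj₂ (v-surj _)))

module Rank {_≺_ : Rel A ℓ} (≺-sto : IsStrictTotalOrder _≡_ _≺_) (A↔Fin : A ↔ Fin m) where
  open IsStrictTotalOrder ≺-sto using (_<?_; irrefl) renaming (trans to ≺-trans)
  open Inverse A↔Fin using (to; from; strictlyInverseˡ; strictlyInverseʳ)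
  open StrictMono ≺-sto

  from-≺? : ∀ a → Decidable (λ k → from k ≺ a)
  from-≺? a k = from k <? a

  below : A → Subset m
  below a = subsetOf (from-≺? a)

  to-∉-below : ∀ a → to a ∉ below a
  to-∉-below a to-a∈ = irrefl refl (subst (_≺ a) (strictlyInverseʳ a) (∈-subsetOf⁻ (from-≺? a) to-a∈))

  below⊂⊤ : ∀ a → below a ⊂ ⊤
  below⊂⊤ a = (λ _ → ∈⊤) , to a , ∈⊤ , to-∉-below a

  below-mono : ∀ {a b} → a ≺ b → below a ⊂ below b
  below-mono {a} {b} a≺b =
    (λ k∈ → ∈-subsetOf⁺ (from-≺? b) (≺-trans (∈-subsetOf⁻ (from-≺? a) k∈) a≺b)) ,
    to a , ∈-subsetOf⁺ (from-≺? b) (subst (_≺ b) (sym (strictlyInverseʳ a)) a≺b) , to-∉-below a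

  rank : A → Fin m
  rank a = fromℕ< (subst (∣ below a ∣ ℕ.<_) (∣⊤∣≡n m) (p⊂q⇒∣p∣<∣q∣ (below⊂⊤ a)))

  rank-mono : Monotonic₁ _≺_ Fin._<_ rank
  rank-mono a≺b = subst₂ ℕ._<_ (sym (Fin.toℕ-fromℕ< _)) (sym (Fin.toℕ-fromℕ< _))
    (p⊂q⇒∣p∣<∣q∣ (below-mono a≺b))

  rank-surjective : StrictlySurjective _≡_ rank
  rank-surjective k with injective⇒strictlySurjective rank∘from-injective k
    where
    rank∘from-injective : Injective _≡_ _≡_ (rank ∘ from)
    rank∘from-injective {x} {y} eq = begin
      x             ≡⟨ strictlyInverseˡ x ⟨
      to (from x)   ≡⟨ cong to (injective {u = rank} rank-mono eq) ⟩
      to (from y)   ≡⟨ strictlyInverseˡ y ⟩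
      y             ∎
      where open ≡-Reasoning
  ... | x , eq = from x , eq

rot-zero : (i : Fin (ℕ.suc n)) → rot i zero ≡ i
rot-zero {n} i = Fin.toℕ-injective (begin
  toℕ (rot i zero)              ≡⟨ Fin.toℕ-fromℕ< _ ⟩
  (toℕ i ℕ.+ 0) % ℕ.suc n       ≡⟨ cong (_% ℕ.suc n) (ℕ.+-identityʳ (toℕ i)) ⟩
  toℕ i % ℕ.suc n               ≡⟨ m<n⇒m%n≡m (Fin.toℕ<n i) ⟩
  toℕ i                         ∎)
  where open ≡-Reasoning

LexLt⇔head : {x y : Point (ℕ.suc n) m} (i : Fin (ℕ.suc n)) → (x i ≡ y i → x ≡ y) →
  LexLt i x y ⇔ x i Fin.< y i
LexLt⇔head {x = x} {y} i rigid =
  mk⇔ head (λ lt → zero , (λ _ ()) , subst (λ j → x j Fin.< y j) (sym (rot-zero i)) lt)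
  where
  head : LexLt i x y → x i Fin.< y i
  head (zero , _ , lt) = subst (λ j → x j Fin.< y j) (rot-zero i) lt
  head (suc k , agree , lt) with rigid (subst (λ j → x j ≡ y j) (rot-zero i) (agree zero (s≤s z≤n)))
  ... | refl = ⊥-elim (Fin.<-irrefl refl lt)

ProdLt⇔pointwise : {x y : Point (ℕ.suc n) m} → (∀ j → x j ≡ y j → x ≡ y) →
  ProdLt x y ⇔ (∀ j → x j Fin.< y j)
ProdLt⇔pointwise {x = x} {y} rigid = mk⇔
  (λ (≤s , x≢y) j → Fin.≤∧≢⇒< (≤s j) (x≢y ∘ rigid j))
  (λ <s → ℕ.<⇒≤ ∘ <s , λ x≡y → Fin.<-irrefl (cong-app x≡y zero) (<s zero))

module Canonical {n m} (A↔Fin : A ↔ Fin m) (P : PORealizers (ℕ.suc n) A) where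
  open PORealizers P
  module R (i : Fin (ℕ.suc n)) = Rank (lt-linear i) A↔Fin

  embed : A → Point (ℕ.suc n) m
  embed a i = R.rank i a

  embed-rigid : IsRigid embed
  embed-rigid a b i = StrictMono.injective (lt-linear i) {u = R.rank i} (R.rank-mono i)

  embed-agree⇒≡ : ∀ a b i → embed a i ≡ embed b i → embed a ≡ embed b
  embed-agree⇒≡ a b i = cong embed ∘ embed-rigid a b i

  lt⇔coordinate : ∀ i a b → lt i a b ⇔ embed a i Fin.< embed b i
  lt⇔coordinate i a b = mk⇔ (R.rank-mono i) (StrictMono.reflects (lt-linear i) {u = R.rank i} (R.rank-mono i))

  embed-isEmbedding : IsEmbedding P embed
  embed-isEmbedding = record
    { injective = λ a b fa≡fb → embed-rigid a b zero (cong-app fa≡fb zero)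
    ; pres-<    = λ a b →
        ⇔-sym (ProdLt⇔pointwise (embed-agree⇒≡ a b)) ⇔-∘
        (mk⇔ (λ lts i → Equivalence.to (lt⇔coordinate i a b) (lts i))
             (λ <s i → Equivalence.from (lt⇔coordinate i a b) (<s i)) ⇔-∘
         <-realized a b)
    ; pres-lt   = λ i a b → ⇔-sym (LexLt⇔head i (embed-agree⇒≡ a b i)) ⇔-∘ lt⇔coordinate i a b
    }

  embed-isRigidEmbedding : IsRigidEmbedding P embed
  embed-isRigidEmbedding = record { embedding = embed-isEmbedding ; rigid = embed-rigid }

  embed-unique : (g : A → Point (ℕ.suc n) m) → IsRigidEmbedding P g → ∀ a i → g a i ≡ embed a i
  embed-unique g g-rigidEmb a i =
    StrictMono.unique (lt-linear i) g-mono (R.rank-mono i) (R.rank-surjective i) a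
    where
    open IsRigidEmbedding g-rigidEmb
    g-mono : Monotonic₁ (lt i) Fin._<_ (λ b → g b i)
    g-mono {b} {c} b<c = Equivalence.to (LexLt⇔head i (cong g ∘ rigid b c i))
      (Equivalence.to (IsEmbedding.pres-lt embedding i b c) b<c)

lemma5p5 : (n : ℕ) → 2 ≤ n → (m : ℕ) (A : Set) → A ↔ Fin m → (P : PORealizers n A) →
    Σ[ f ∈ (A → Point n m) ] (IsRigidEmbedding P f
    × ((g : A → Point n m) → IsRigidEmbedding P g → (a : A) (j : Fin n) → g a j ≡ f a j))
lemma5p5 (ℕ.suc n) _ m A A↔Fin P = embed , embed-isRigidEmbedding , embed-unique
  where open Canonical A↔Fin P
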